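{- Let $G$ be a connected finite simple graph of order $n\ge 3$ such that $C_{tr}(G)=n$. Then (1) $\gamma_{tr}(G)=2$; (2) $\delta(G)\ge 2$; (3) $G$ has diameter at most $2$.
   Context: A set $S\subseteq V$ is a total restrained dominating set (TRD-set) of $G=(V,E)$ if every vertex of $V\setminus S$ is adjacent to at least one vertex of $S$ and to at least one other vertex of $V\setminus S$, and every vertex of $S$ is adjacent to at least one other vertex of $S$. $\gamma_{tr}(G)$ is the minimum cardinality of a TRD-set of $G$. Two disjoint sets $X,Y\subseteq V$ form a total restrained coalition if neither is a TRD-set but $X\cup Y$ is a TRD-set. A trc-partition of $G$ is a partition $\Phi$ of $V$ such that no member of $\Phi$ is a TRD-set and each member forms a total restrained coalition with some other member of $\Phi$. $C_{tr}(G)$ is the maximum cardinality of a trc-partition of $G$. $\delta(G)$ is the minimum degree. -}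

module Defs where

open import Data.Nat using (ℕ; _≤_)
open import Data.Fin using (Fin; _≟_)
open import Data.Fin.Subset using (Subset; _∈_; _∉_; _∪_; ∣_∣)
open import Data.Bool using (Bool; T)
open import Data.Vec using (tabulate)
open import Data.Product using (Σ; ∃; ∃-syntax; _×_)
open import Relation.Nullary using (¬_; Dec)
open import Relation.Nullary.Decidable using (⌊_⌋)
open import Relation.Binary.PropositionalEquality using (_≡_; _≢_)
open import Function using (Surjective)

record Graph (n : ℕ) : Set where
  field
    adj   : Fin n → Fin n → Bool
    sym   : ∀ u v → adj u v ≡ adj v u
    irrefl : ∀ v → adj v v ≡ Bool.false
  Adj : Fin n → Fin n → Set
  Adj u v = T (adj u v)
open Graph public
  using (Adj)

module _ {n : ℕ} (G : Graph n) where
  open Graph G using (adj)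

  data Walk : Fin n → Fin n → Set where
    here : ∀ {v} → Walk v v
    step : ∀ {u w v} → Adj G u w → Walk w v → Walk u v

  Connected : Set
  Connected = ∀ u v → Walk u v

  N : Fin n → Subset n
  N v = tabulate (adj v)

  degree : Fin n → ℕ
  degree v = ∣ N v ∣

  IsTRD : Subset n → Set
  IsTRD S =
    (∀ v → v ∉ S → (∃[ u ] (u ∈ S × Adj G v u)) × (∃[ w ] (w ∉ S × Adj G v w)))
    × (∀ v → v ∈ S → ∃[ u ] (u ∈ S × Adj G v u))

  γtr≡ : ℕ → Set
  γtr≡ m = (Σ (Subset n) λ S → IsTRD S × ∣ S ∣ ≡ m)
         × (∀ S → IsTRD S → m ≤ ∣ S ∣)

  -- A partition of V into k (nonempty) parts, given by a surjective class map.
  part : ∀ {k} → (Fin n → Fin k) → Fin k → Subset n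
  part f i = tabulate (λ v → ⌊ f v ≟ i ⌋)

  IsTRCPartition : (k : ℕ) → (Fin n → Fin k) → Set
  IsTRCPartition k f =
    Surjective _≡_ _≡_ f
    × (∀ i → ¬ IsTRD (part f i))
    × (∀ i → ∃[ j ] (j ≢ i × IsTRD (part f i ∪ part f j)))

  HasTRCPartitionOfSize : ℕ → Set
  HasTRCPartitionOfSize k = Σ (Fin n → Fin k) (IsTRCPartition k)

  Ctr≡ : ℕ → Set
  Ctr≡ m = HasTRCPartitionOfSize m × (∀ k → HasTRCPartitionOfSize k → k ≤ m)

  DiameterAtMost2 : Set
  DiameterAtMost2 = ∀ u v → u ≡ v ⊎′ (Adj G u v ⊎′ ∃[ w ] (Adj G u w × Adj G w v))
    where open import Data.Sum renaming (_⊎_ to _⊎′_)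

-- An n-part trc-partition of an n-vertex graph consists of singletons, so every
-- vertex v has a partner w with {v, w} a TRD-set; totality forces vw to be an edge.
-- Every TRD-set contains two adjacent vertices, hence γ_tr = 2. A vertex outside a
-- TRD-pair {z, w} has a neighbour inside it and another outside it, which bounds all
-- degrees below by 2 and puts any vertex non-adjacent to u next to u's partner.
module Submission where

open import Defs
open import Data.Nat using (ℕ; _≤_; suc; s≤s)
open import Data.Nat.Properties using (1+n≰n)
open import Data.Product using (_×_; _,_; proj₁; proj₂; ∃-syntax)
open import Data.Sum using (_⊎_; inj₁; inj₂)
open import Data.Fin using (Fin; zero; suc; _≟_; punchOut)
open import Data.Fin.Properties using (punchOut-injective; injective⇒≤; any?)
open import Data.Fin.Subset using (Subset; Nonempty; _∈_; _∉_; _∪_; _⊆_; ∣_∣; ⁅_⁆)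
open import Data.Fin.Subset.Properties
  using (x∈p∪q⁻; x∈p∪q⁺; _∈?_; x∈⁅x⁆; x∈⁅y⁆⇒x≡y; ∣⁅x⁆∣≡1; ∪-identityˡ; ∪-identityʳ; p⊆q⇒∣p∣≤∣q∣; ⊆-antisym)
open import Data.Vec using (tabulate)
open import Data.Vec.Properties using ([]=⇒lookup; lookup⇒[]=; lookup∘tabulate)
open import Data.Bool using (Bool; T)
open import Data.Bool.Properties using (T-≡)
open import Data.Empty using (⊥-elim)
open import Relation.Nullary using (¬_; yes; no)
open import Relation.Nullary.Decidable using (⌊_⌋; toWitness; fromWitness; T?)
open import Relation.Binary.PropositionalEquality
  using (_≡_; _≢_; refl; sym; trans; cong; cong₂; subst; module ≡-Reasoning)
open import Function using (Surjective; Injective; _∘_)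
open import Function.Bundles using (module Equivalence)

∈-tabulate⁻ : ∀ {n} (h : Fin n → Bool) {x} → x ∈ tabulate h → T (h x)
∈-tabulate⁻ h {x} x∈ =
  Equivalence.from T-≡ (trans (sym (lookup∘tabulate h x)) ([]=⇒lookup x∈))

∈-tabulate⁺ : ∀ {n} (h : Fin n → Bool) {x} → T (h x) → x ∈ tabulate h
∈-tabulate⁺ h {x} t =
  lookup⇒[]= x (tabulate h) (trans (lookup∘tabulate h x) (Equivalence.to T-≡ t))

module _ {n : ℕ} where

  x∈⁅x⁆∪⁅y⁆ : (x y : Fin n) → x ∈ ⁅ x ⁆ ∪ ⁅ y ⁆
  x∈⁅x⁆∪⁅y⁆ x y = x∈p∪q⁺ (inj₁ (x∈⁅x⁆ x))

  y∈⁅x⁆∪⁅y⁆ : (x y : Fin n) → y ∈ ⁅ x ⁆ ∪ ⁅ y ⁆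
  y∈⁅x⁆∪⁅y⁆ x y = x∈p∪q⁺ (inj₂ (x∈⁅x⁆ y))

  z∈⁅x⁆∪⁅y⁆⇒z≡x⊎z≡y : ∀ {x y z : Fin n} → z ∈ ⁅ x ⁆ ∪ ⁅ y ⁆ → z ≡ x ⊎ z ≡ y
  z∈⁅x⁆∪⁅y⁆⇒z≡x⊎z≡y {x} {y} z∈ with x∈p∪q⁻ ⁅ x ⁆ ⁅ y ⁆ z∈
  ... | inj₁ z∈⁅x⁆ = inj₁ (x∈⁅y⁆⇒x≡y x z∈⁅x⁆)
  ... | inj₂ z∈⁅y⁆ = inj₂ (x∈⁅y⁆⇒x≡y y z∈⁅y⁆)

  z≢x⇒z≢y⇒z∉⁅x⁆∪⁅y⁆ : ∀ {x y z : Fin n} → z ≢ x → z ≢ y → z ∉ ⁅ x ⁆ ∪ ⁅ y ⁆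
  z≢x⇒z≢y⇒z∉⁅x⁆∪⁅y⁆ z≢x z≢y z∈ with z∈⁅x⁆∪⁅y⁆⇒z≡x⊎z≡y z∈
  ... | inj₁ z≡x = z≢x z≡x
  ... | inj₂ z≡y = z≢y z≡y

  ⁅x⁆∪⁅y⁆⊆p : ∀ {x y : Fin n} {p : Subset n} → x ∈ p → y ∈ p → ⁅ x ⁆ ∪ ⁅ y ⁆ ⊆ p
  ⁅x⁆∪⁅y⁆⊆p x∈p y∈p z∈ with z∈⁅x⁆∪⁅y⁆⇒z≡x⊎z≡y z∈
  ... | inj₁ refl = x∈p
  ... | inj₂ refl = y∈p

∣⁅x⁆∪⁅y⁆∣≡2 : ∀ {n} {x y : Fin n} → x ≢ y → ∣ ⁅ x ⁆ ∪ ⁅ y ⁆ ∣ ≡ 2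
∣⁅x⁆∪⁅y⁆∣≡2 {x = zero}  {zero}  x≢y = ⊥-elim (x≢y refl)
∣⁅x⁆∪⁅y⁆∣≡2 {x = zero}  {suc y} _   = cong suc (trans (cong ∣_∣ (∪-identityˡ ⁅ y ⁆)) (∣⁅x⁆∣≡1 y))
∣⁅x⁆∪⁅y⁆∣≡2 {x = suc x} {zero}  _   = cong suc (trans (cong ∣_∣ (∪-identityʳ ⁅ x ⁆)) (∣⁅x⁆∣≡1 x))
∣⁅x⁆∪⁅y⁆∣≡2 {x = suc x} {suc y} x≢y = ∣⁅x⁆∪⁅y⁆∣≡2 (x≢y ∘ cong suc)

x∈p⇒y∈p⇒x≢y⇒2≤∣p∣ : ∀ {n} {x y : Fin n} {p : Subset n} → x ∈ p → y ∈ p → x ≢ y → 2 ≤ ∣ p ∣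
x∈p⇒y∈p⇒x≢y⇒2≤∣p∣ x∈p y∈p x≢y =
  subst (_≤ _) (∣⁅x⁆∪⁅y⁆∣≡2 x≢y) (p⊆q⇒∣p∣≤∣q∣ (⁅x⁆∪⁅y⁆⊆p x∈p y∈p))

injective⇒surjective : ∀ {n} {g : Fin n → Fin n} → Injective _≡_ _≡_ g → ∀ y → ∃[ x ] g x ≡ y
injective⇒surjective {suc m} {g} g-inj y with any? (λ x → g x ≟ y)
... | yes hit = hit
... | no miss = ⊥-elim (1+n≰n (injective⇒≤ {f = avoid-y} avoid-y-injective))
  where
    avoid-y : Fin (suc m) → Fin m
    avoid-y x = punchOut {i = y} (λ y≡gx → miss (x , sym y≡gx))

    avoid-y-injective : Injective _≡_ _≡_ avoid-y
    avoid-y-injective eq = g-inj (punchOut-injective {i = y} _ _ eq)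

surjective⇒injective : ∀ {n} {f : Fin n → Fin n} → Surjective _≡_ _≡_ f → Injective _≡_ _≡_ f
surjective⇒injective {n} {f} surj {x} {y} fx≡fy = begin
  x         ≡⟨ sym (g∘f≗id x) ⟩
  g (f x)   ≡⟨ cong g fx≡fy ⟩
  g (f y)   ≡⟨ g∘f≗id y ⟩
  y         ∎
  where
    open ≡-Reasoning

    g : Fin n → Fin n
    g i = proj₁ (surj i)

    f∘g≗id : ∀ i → f (g i) ≡ i
    f∘g≗id i = proj₂ (surj i) refl

    g-injective : Injective _≡_ _≡_ g
    g-injective {i} {j} gi≡gj = trans (sym (f∘g≗id i)) (trans (cong f gi≡gj) (f∘g≗id j))

    g∘f≗id : ∀ z → g (f z) ≡ z
    g∘f≗id z with injective⇒surjective g-injective z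
    ... | i , refl = cong g (f∘g≗id i)

module _ {n : ℕ} (G : Graph n) where

  Adj-sym : ∀ {u v} → Adj G u v → Adj G v u
  Adj-sym {u} {v} = subst T (Graph.sym G u v)

  Adj-irrefl : ∀ {v} → ¬ Adj G v v
  Adj-irrefl {v} = subst T (Graph.irrefl G v)

  Adj⇒≢ : ∀ {u v} → Adj G u v → u ≢ v
  Adj⇒≢ uv refl = Adj-irrefl uv

  two-neighbours⇒2≤degree : ∀ {v x y} → Adj G v x → Adj G v y → x ≢ y → 2 ≤ degree G v
  two-neighbours⇒2≤degree {v} vx vy =
    x∈p⇒y∈p⇒x≢y⇒2≤∣p∣ (∈-tabulate⁺ (Graph.adj G v) vx) (∈-tabulate⁺ (Graph.adj G v) vy)

  IsTRD⇒Nonempty : ∀ {S} → Fin n → IsTRD G S → Nonempty S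
  IsTRD⇒Nonempty {S} v (dominating , _) with v ∈? S
  ... | yes v∈S = v , v∈S
  ... | no v∉S with proj₁ (dominating v v∉S)
  ...   | u , u∈S , _ = u , u∈S

  IsTRD⇒2≤∣S∣ : ∀ {S} → Fin n → IsTRD G S → 2 ≤ ∣ S ∣
  IsTRD⇒2≤∣S∣ v trd@(_ , total) with IsTRD⇒Nonempty v trd
  ... | u , u∈S with total u u∈S
  ...   | u′ , u′∈S , uu′ = x∈p⇒y∈p⇒x≢y⇒2≤∣p∣ u∈S u′∈S (Adj⇒≢ uu′)

  ∉-IsTRD⇒2≤degree : ∀ {S v} → IsTRD G S → v ∉ S → 2 ≤ degree G v
  ∉-IsTRD⇒2≤degree (dominating , _) v∉S with dominating _ v∉S
  ... | (u , u∈S , vu) , (w , w∉S , vw) =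
    two-neighbours⇒2≤degree vu vw (λ { refl → w∉S u∈S })

  IsTRD-pair⇒Adj : ∀ {v w} → IsTRD G (⁅ v ⁆ ∪ ⁅ w ⁆) → Adj G v w
  IsTRD-pair⇒Adj {v} {w} (_ , total) with total v (x∈⁅x⁆∪⁅y⁆ v w)
  ... | u , u∈ , vu with z∈⁅x⁆∪⁅y⁆⇒z≡x⊎z≡y u∈
  ...   | inj₁ refl = ⊥-elim (Adj-irrefl vu)
  ...   | inj₂ refl = vu

  IsTRD-pair⇒dominates : ∀ {v w x} → IsTRD G (⁅ v ⁆ ∪ ⁅ w ⁆) → x ≢ v → x ≢ w →
                         Adj G x v ⊎ Adj G x w
  IsTRD-pair⇒dominates (dominating , _) x≢v x≢w
    with proj₁ (dominating _ (z≢x⇒z≢y⇒z∉⁅x⁆∪⁅y⁆ x≢v x≢w))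
  ... | u , u∈ , xu with z∈⁅x⁆∪⁅y⁆⇒z≡x⊎z≡y u∈
  ...   | inj₁ refl = inj₁ xu
  ...   | inj₂ refl = inj₂ xu

  HasTRDPartners : Set
  HasTRDPartners = ∀ v → ∃[ w ] IsTRD G (⁅ v ⁆ ∪ ⁅ w ⁆)

  ∈-part⁻ : ∀ {k} {f : Fin n → Fin k} {i x} → x ∈ part G f i → f x ≡ i
  ∈-part⁻ {f = f} {i} x∈ = toWitness (∈-tabulate⁻ (λ y → ⌊ f y ≟ i ⌋) x∈)

  ∈-part⁺ : ∀ {k} {f : Fin n → Fin k} {i x} → f x ≡ i → x ∈ part G f i
  ∈-part⁺ {f = f} {i} fx≡i = ∈-tabulate⁺ (λ y → ⌊ f y ≟ i ⌋) (fromWitness fx≡i)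

  injective⇒part≡⁅⁆ : ∀ {k} {f : Fin n → Fin k} → Injective _≡_ _≡_ f → ∀ v → part G f (f v) ≡ ⁅ v ⁆
  injective⇒part≡⁅⁆ {f = f} f-inj v = ⊆-antisym
    (λ x∈ → subst (_∈ ⁅ v ⁆) (sym (f-inj (∈-part⁻ x∈))) (x∈⁅x⁆ v))
    (λ {x} x∈ → ∈-part⁺ (cong f (x∈⁅y⁆⇒x≡y v x∈)))

  trcPartition⇒HasTRDPartners : HasTRCPartitionOfSize G n → HasTRDPartners
  trcPartition⇒HasTRDPartners (f , surj , _ , coalition) v with coalition (f v)
  ... | j , _ , trd = w , subst (IsTRD G) (cong₂ _∪_ (part≡⁅⁆ v) part-j≡⁅w⁆) trd
    where
      part≡⁅⁆ : ∀ x → part G f (f x) ≡ ⁅ x ⁆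
      part≡⁅⁆ = injective⇒part≡⁅⁆ (surjective⇒injective surj)

      w : Fin n
      w = proj₁ (surj j)

      part-j≡⁅w⁆ : part G f j ≡ ⁅ w ⁆
      part-j≡⁅w⁆ = trans (cong (part G f) (sym (proj₂ (surj j) refl))) (part≡⁅⁆ w)

  HasTRDPartners⇒γtr≡2 : Fin n → HasTRDPartners → γtr≡ G 2
  HasTRDPartners⇒γtr≡2 v partner =
    (⁅ v ⁆ ∪ ⁅ w ⁆ , trd , ∣⁅x⁆∪⁅y⁆∣≡2 (Adj⇒≢ (IsTRD-pair⇒Adj trd))) , λ _ → IsTRD⇒2≤∣S∣ v
    where
      w : Fin n
      w = proj₁ (partner v)

      trd : IsTRD G (⁅ v ⁆ ∪ ⁅ w ⁆)
      trd = proj₂ (partner v)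

  HasTRDPartners⇒2≤degree : (∀ (a b : Fin n) → ∃[ c ] (c ≢ a × c ≢ b)) →
                             HasTRDPartners → ∀ v → 2 ≤ degree G v
  HasTRDPartners⇒2≤degree third partner v with partner v
  ... | w , vw-trd with third v w
  ... | z , z≢v , z≢w with partner z
  ... | w′ , zw′-trd with v ≟ w′
  ... | yes refl = two-neighbours⇒2≤degree
                     (IsTRD-pair⇒Adj vw-trd) (Adj-sym (IsTRD-pair⇒Adj zw′-trd)) (z≢w ∘ sym)
  ... | no v≢w′ = ∉-IsTRD⇒2≤degree zw′-trd (z≢x⇒z≢y⇒z∉⁅x⁆∪⁅y⁆ (z≢v ∘ sym) v≢w′)

  HasTRDPartners⇒diameter≤2 : HasTRDPartners → DiameterAtMost2 G
  HasTRDPartners⇒diameter≤2 partner u v with u ≟ v | T? (Graph.adj G u v)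
  ... | yes u≡v | _      = inj₁ u≡v
  ... | no _    | yes uv = inj₂ (inj₁ uv)
  ... | no u≢v  | no ¬uv with partner u
  ... | w , uw-trd
    with IsTRD-pair⇒dominates uw-trd (u≢v ∘ sym) (λ { refl → ¬uv (IsTRD-pair⇒Adj uw-trd) })
  ... | inj₁ vu = ⊥-elim (¬uv (Adj-sym vu))
  ... | inj₂ vw = inj₂ (inj₂ (w , IsTRD-pair⇒Adj uw-trd , Adj-sym vw))

third-element : ∀ {m} (a b : Fin (suc (suc (suc m)))) → ∃[ c ] (c ≢ a × c ≢ b)
third-element zero          zero          = suc zero , (λ ()) , (λ ())
third-element zero          (suc zero)    = suc (suc zero) , (λ ()) , (λ ())
third-element zero          (suc (suc _)) = suc zero , (λ ()) , (λ ())
third-element (suc zero)    zero          = suc (suc zero) , (λ ()) , (λ ())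
third-element (suc (suc _)) zero          = suc zero , (λ ()) , (λ ())
third-element (suc _)       (suc _)       = zero , (λ ()) , (λ ())

proposition4p2 : (n : ℕ) (G : Graph n) → 3 ≤ n → Connected G → Ctr≡ G n →
    γtr≡ G 2 × (∀ v → 2 ≤ degree G v) × DiameterAtMost2 G
proposition4p2 (suc (suc (suc _))) G (s≤s (s≤s (s≤s _))) _ (trc , _) =
    HasTRDPartners⇒γtr≡2 G zero partners
  , HasTRDPartners⇒2≤degree G third-element partners
  , HasTRDPartners⇒diameter≤2 G partners
  where
    partners : HasTRDPartners G
    partners = trcPartition⇒HasTRDPartners G trc
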